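{- If $H$ is a $4$-chromatic graph, then the number of nearly proper colourings of $H$ is at most \[\mathrm{crit}(H)\cdot 3^{k(H)}\cdot 2^{v(H)-k(H)-1}.\]
   Context: All graphs are finite and simple; $v(H)=|V(H)|$, $k(H)$ is the number of connected components, $\chi(H)$ the chromatic number. An edge $e$ is critical if $\chi(H-e)<\chi(H)$; $\mathrm{crit}(H)$ is the number of critical edges of $H$. A vertex colouring $f:V(H)\to\{1,\dots,\chi(H)-1\}$ is nearly proper if there is exactly one edge of $H$ whose two endpoints receive the same colour. -}

module Defs where

open import Data.Nat using (ℕ; zero; suc; _<ᵇ_; _≡ᵇ_)
open import Data.Bool using (Bool; true; false; _∧_; _∨_; not)
open import Data.Fin using (Fin; toℕ)
open import Data.Vec using (Vec; []; _∷_; lookup)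
open import Data.Bool.ListAction using (any)
open import Data.List using (List; []; _∷_; map; filterᵇ; length; allFin; upTo; cartesianProduct; concatMap)
open import Data.Product using (_×_; _,_)
open import Relation.Binary.PropositionalEquality using (_≡_)

Adj : ℕ → Set
Adj n = Fin n → Fin n → Bool

record Graph (n : ℕ) : Set where
  field
    adj    : Adj n
    sym    : ∀ i j → adj i j ≡ adj j i
    irrefl : ∀ i → adj i i ≡ false
open Graph public

_=ᶠ_ : ∀ {n} → Fin n → Fin n → Bool
i =ᶠ j = toℕ i ≡ᵇ toℕ j

v : ∀ {n} → Graph n → ℕ
v {n} _ = n

-- E(H): each edge {i,j} listed exactly once, as the pair (i , j) with i < j
edgeList : ∀ {n} → Adj n → List (Fin n × Fin n)
edgeList {n} a =
  filterᵇ (λ { (i , j) → (toℕ i <ᵇ toℕ j) ∧ a i j })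
          (cartesianProduct (allFin n) (allFin n))

deleteEdge : ∀ {n} → Adj n → Fin n × Fin n → Adj n
deleteEdge a (x , y) i j =
  a i j ∧ not (((i =ᶠ x) ∧ (j =ᶠ y)) ∨ ((i =ᶠ y) ∧ (j =ᶠ x)))

allColourings : (k n : ℕ) → List (Vec (Fin k) n)
allColourings k zero    = [] ∷ []
allColourings k (suc n) =
  concatMap (λ c → map (c ∷_) (allColourings k n)) (allFin k)

monoEdges : ∀ {n k} → Adj n → Vec (Fin k) n → ℕ
monoEdges a f =
  length (filterᵇ (λ { (i , j) → lookup f i =ᶠ lookup f j }) (edgeList a))

isProper : ∀ {n k} → Adj n → Vec (Fin k) n → Bool
isProper a f = monoEdges a f ≡ᵇ 0

colourable : ∀ {n} → Adj n → ℕ → Bool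
colourable {n} a k = any (isProper a) (allColourings k n)

-- χ : least k ≤ n such that the graph is k-colourable
-- (every graph on n vertices is n-colourable, so the default n is never used
--  as a fallback value on a genuine graph)
chi : ∀ {n} → Adj n → ℕ
chi {n} a = go (upTo (suc n))
  where
    go : List ℕ → ℕ
    go []       = n
    go (k ∷ ks) with colourable a k
    ... | true  = k
    ... | false = go ks

χ : ∀ {n} → Graph n → ℕ
χ G = chi (adj G)

isCritical : ∀ {n} → Adj n → Fin n × Fin n → Bool
isCritical a e = chi (deleteEdge a e) <ᵇ chi a

crit : ∀ {n} → Graph n → ℕ
crit G = length (filterᵇ (isCritical (adj G)) (edgeList (adj G)))

-- nearly proper colouring with colours {1,…,χ(H)-1} (here Fin (χ(H) ∸ 1)):
-- exactly one edge is monochromatic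
isNearlyProper : ∀ {n k} → Adj n → Vec (Fin k) n → Bool
isNearlyProper a f = monoEdges a f ≡ᵇ 1

nearlyProperCount : ∀ {n} → Graph n → (k : ℕ) → ℕ
nearlyProperCount {n} G k =
  length (filterᵇ (isNearlyProper (adj G)) (allColourings k n))

reachWithin : ∀ {n} → Adj n → ℕ → Fin n → Fin n → Bool
reachWithin a zero    i j = i =ᶠ j
reachWithin {n} a (suc t) i j =
  reachWithin a t i j ∨ any (λ l → reachWithin a t i l ∧ a l j) (allFin n)

-- i and j lie in the same component (walks of length ≤ n suffice)
connected : ∀ {n} → Adj n → Fin n → Fin n → Bool
connected {n} a = reachWithin a n

-- k(H): count the vertices that are the smallest vertex of their component
k : ∀ {n} → Graph n → ℕ
k {n} G = length (filterᵇ isLeast (allFin n))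
  where
    isLeast : Fin n → Bool
    isLeast i = not (any (λ j → (toℕ j <ᵇ toℕ i) ∧ connected (adj G) j i) (allFin n))

module Submission where

-- A nearly proper 3-colouring f of H has exactly one monochromatic edge xy, and f is a
-- proper colouring of H − xy, so χ(H − xy) ≤ 3 and xy is critical. It therefore suffices
-- to show that, for a fixed edge xy, at most 3^k · 2^(n−k−1) colourings are proper on
-- H − xy and give x and y the same colour.
--
-- Take a breadth-first spanning forest rooted at the least vertex of each component and
-- call z the endpoint of xy that comes later in the order (root, depth, vertex), w the
-- other one. Encode such a colouring by the colour of each root, the colour of every other
-- vertex v ≠ z relative to the (different) colour of its parent — one of 2 values — and
-- nothing at z, whose colour is that of w. Parents and w come earlier in the order, so
-- the colouring is decoded by induction along it, and counting codes gives the bound.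

open import Defs hiding (sym)
open import Data.Nat using (ℕ; _≤_; _*_; _∸_; _^_)
open import Relation.Binary.PropositionalEquality using (_≡_)

open import Data.Bool using (Bool; true; false; T; _∧_; _∨_; not; if_then_else_)
open import Data.Bool.ListAction using (any)
open import Data.Bool.Properties using (T-∧; T-∨)
open import Data.Empty using (⊥-elim)
open import Data.Fin using (Fin; zero; suc; toℕ; fromℕ; fromℕ<; inject₁; punchOut; _≟_)
open import Data.Fin.Properties
  using ( toℕ-injective; toℕ<n; toℕ≤pred[n]; toℕ-fromℕ; toℕ-fromℕ<; toℕ-inject₁
        ; inject₁-injective; punchOut-injective)
open import Data.List
  using (List; []; _∷_; _++_; length; map; filterᵇ; allFin; tabulate; cartesianProduct; cartesianProductWith; concatMap)
open import Data.List.Membership.Propositional using (_∈_; lose)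
open import Data.List.Membership.Propositional.Properties
  using (∈-∃++; ∈-allFin; ∈-cartesianProductWith⁺; ∈-cartesianProduct⁺; ∈-filter⁺; ∈-filter⁻)
open import Data.List.Properties using (length-++; filter-++; filter-none; map-cong)
open import Data.List.Relation.Unary.All as All using (All; [])
open import Data.List.Relation.Unary.All.Properties using (all-filter)
open import Data.List.Relation.Unary.AllPairs using ([]; _∷_)
open import Data.List.Relation.Unary.Any using (here; there; satisfied)
open import Data.List.Relation.Unary.Any.Properties using (any⁺; any⁻; singleton⁻)
open import Data.List.Relation.Unary.Unique.Propositional using (Unique)
import Data.List.Relation.Unary.Unique.Propositional.Properties as Unique
open import Data.Nat using (suc; zero; pred; _+_; _<_; _<ᵇ_; _≡ᵇ_; z≤n; s≤s; NonZero; >-nonZero⁻¹)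
open import Data.Nat.Induction using (<-wellFounded)
open import Data.Nat.ListAction using (sum)
open import Data.Nat.Properties hiding (_≟_)
open import Algebra.Properties.CommutativeSemigroup +-commutativeSemigroup
  using () renaming (interchange to +-interchange)
open import Algebra.Properties.CommutativeSemigroup *-commutativeSemigroup
  using () renaming (x∙yz≈y∙xz to *-left-comm)
open import Data.Product using (∃-syntax; _×_; _,_; proj₁; proj₂; swap)
open import Data.Product.Properties using (,-injective)
open import Data.Sum using (_⊎_; inj₁; inj₂)
open import Data.Vec using (Vec; []; _∷_; lookup)
import Data.Vec as Vec
import Data.Vec.Properties as Vecₚ
open import Function using (_∘_)
open import Function.Bundles using (Equivalence)
import Induction.WellFounded as WF
open import Relation.Binary.Construct.On as On using ()
open import Relation.Binary.Definitions using (tri<; tri≈; tri>)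
open import Relation.Binary.PropositionalEquality
  using (_≢_; refl; sym; trans; cong; cong₂; subst; subst₂; module ≡-Reasoning)
open import Relation.Nullary using (¬_; contradiction; yes; no)
open import Relation.Nullary.Decidable using (T?)

private
  variable
    A B C E : Set

𝟙 : Bool → ℕ
𝟙 true  = 1
𝟙 false = 0

𝟙-∧ : ∀ b c → 𝟙 (b ∧ c) ≡ 𝟙 b * 𝟙 c
𝟙-∧ true  c = sym (+-identityʳ (𝟙 c))
𝟙-∧ false c = refl

countᵇ : (A → Bool) → List A → ℕ
countᵇ p xs = length (filterᵇ p xs)

countᵇ-∷ : (p : A → Bool) (x : A) (xs : List A) → countᵇ p (x ∷ xs) ≡ 𝟙 (p x) + countᵇ p xs
countᵇ-∷ p x xs with p x
... | true  = refl
... | false = refl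

countᵇ-++ : (p : A → Bool) (xs ys : List A) → countᵇ p (xs ++ ys) ≡ countᵇ p xs + countᵇ p ys
countᵇ-++ p xs ys = trans (cong length (filter-++ (T? ∘ p) xs ys)) (length-++ (filterᵇ p xs))

sum-map-+ : (f g : A → ℕ) (xs : List A) →
            sum (map (λ x → f x + g x) xs) ≡ sum (map f xs) + sum (map g xs)
sum-map-+ f g []       = refl
sum-map-+ f g (x ∷ xs) = trans (cong (f x + g x +_) (sum-map-+ f g xs)) (+-interchange (f x) (g x) _ _)

∈⇒≤sum-map : (f : A → ℕ) {x : A} {xs : List A} → x ∈ xs → f x ≤ sum (map f xs)
∈⇒≤sum-map f {xs = y ∷ xs} (here refl)  = m≤m+n (f y) _
∈⇒≤sum-map f {xs = y ∷ xs} (there x∈xs) = ≤-trans (∈⇒≤sum-map f x∈xs) (m≤n+m _ (f y))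

sum-map-≤ : (f : A → ℕ) (b : ℕ) (xs : List A) → (∀ {x} → x ∈ xs → f x ≤ b) →
            sum (map f xs) ≤ length xs * b
sum-map-≤ f b []       _   = z≤n
sum-map-≤ f b (x ∷ xs) f≤b = +-mono-≤ (f≤b (here refl)) (sum-map-≤ f b xs (f≤b ∘ there))

countᵇ-union-bound : (P : A → Bool) (Q : E → A → Bool) (es : List E) (xs : List A) →
                     (∀ x → T (P x) → ∃[ e ] e ∈ es × T (Q e x)) →
                     countᵇ P xs ≤ sum (map (λ e → countᵇ (Q e) xs) es)
countᵇ-union-bound P Q es []       _       = z≤n
countᵇ-union-bound P Q es (x ∷ xs) covered = begin
  countᵇ P (x ∷ xs)                                 ≡⟨ countᵇ-∷ P x xs ⟩
  𝟙 (P x) + countᵇ P xs                              ≤⟨ +-mono-≤ head (countᵇ-union-bound P Q es xs covered) ⟩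
  sum (map (λ e → 𝟙 (Q e x)) es) + sum (map (λ e → countᵇ (Q e) xs) es)
    ≡⟨ sum-map-+ (λ e → 𝟙 (Q e x)) (λ e → countᵇ (Q e) xs) es ⟨
  sum (map (λ e → 𝟙 (Q e x) + countᵇ (Q e) xs) es)  ≡⟨ cong sum (map-cong (λ e → sym (countᵇ-∷ (Q e) x xs)) es) ⟩
  sum (map (λ e → countᵇ (Q e) (x ∷ xs)) es)         ∎
  where
  open ≤-Reasoning
  head : 𝟙 (P x) ≤ sum (map (λ e → 𝟙 (Q e x)) es)
  head with P x in Px
  ... | false = z≤n
  ... | true with e , e∈es , Qex ← covered x (subst T (sym Px) _) =
    ≤-trans (𝟙-T Qex) (∈⇒≤sum-map (λ e → 𝟙 (Q e x)) e∈es)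
    where
    𝟙-T : ∀ {b} → T b → 1 ≤ 𝟙 b
    𝟙-T {true} _ = ≤-refl

countᵇ-cartesianProductWith : (f : A → B → C) (P : C → Bool) (p : A → Bool) (r : B → Bool) →
  (∀ x y → P (f x y) ≡ p x ∧ r y) → (xs : List A) (ys : List B) →
  countᵇ P (cartesianProductWith f xs ys) ≡ countᵇ p xs * countᵇ r ys
countᵇ-cartesianProductWith f P p r P≡ []       ys = refl
countᵇ-cartesianProductWith f P p r P≡ (x ∷ xs) ys = begin
  countᵇ P (map (f x) ys ++ cartesianProductWith f xs ys)    ≡⟨ countᵇ-++ P (map (f x) ys) _ ⟩
  countᵇ P (map (f x) ys) + countᵇ P (cartesianProductWith f xs ys)
    ≡⟨ cong₂ _+_ (row ys) (countᵇ-cartesianProductWith f P p r P≡ xs ys) ⟩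
  𝟙 (p x) * countᵇ r ys + countᵇ p xs * countᵇ r ys          ≡⟨ *-distribʳ-+ (countᵇ r ys) (𝟙 (p x)) _ ⟨
  (𝟙 (p x) + countᵇ p xs) * countᵇ r ys                      ≡⟨ cong (_* countᵇ r ys) (countᵇ-∷ p x xs) ⟨
  countᵇ p (x ∷ xs) * countᵇ r ys                            ∎
  where
  open ≡-Reasoning
  row : ∀ ys → countᵇ P (map (f x) ys) ≡ 𝟙 (p x) * countᵇ r ys
  row []       = sym (*-zeroʳ (𝟙 (p x)))
  row (y ∷ ys) = begin
    countᵇ P (f x y ∷ map (f x) ys)             ≡⟨ countᵇ-∷ P (f x y) _ ⟩
    𝟙 (P (f x y)) + countᵇ P (map (f x) ys)      ≡⟨ cong₂ _+_ (trans (cong 𝟙 (P≡ x y)) (𝟙-∧ (p x) (r y))) (row ys) ⟩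
    𝟙 (p x) * 𝟙 (r y) + 𝟙 (p x) * countᵇ r ys   ≡⟨ *-distribˡ-+ (𝟙 (p x)) (𝟙 (r y)) _ ⟨
    𝟙 (p x) * (𝟙 (r y) + countᵇ r ys)           ≡⟨ cong (𝟙 (p x) *_) (countᵇ-∷ r y ys) ⟨
    𝟙 (p x) * countᵇ r (y ∷ ys)                 ∎

∈-delete : (as : List A) {x y : A} {bs : List A} → x ∈ as ++ y ∷ bs → x ≢ y → x ∈ as ++ bs
∈-delete []       (here refl) x≢y = ⊥-elim (x≢y refl)
∈-delete []       (there x∈)  _   = x∈
∈-delete (a ∷ as) (here refl) _   = here refl
∈-delete (a ∷ as) (there x∈)  x≢y = there (∈-delete as x∈ x≢y)

length-≤-injection : (φ : A → B) {xs : List A} {ys : List B} → Unique xs →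
                     (∀ {x y} → x ∈ xs → y ∈ xs → φ x ≡ φ y → x ≡ y) →
                     (∀ {x} → x ∈ xs → φ x ∈ ys) → length xs ≤ length ys
length-≤-injection φ {[]}     _              _   _    = z≤n
length-≤-injection φ {x ∷ xs} (x∉xs ∷ uniq) inj into
  with as , bs , refl ← ∈-∃++ (into (here refl)) = begin
    suc (length xs)                ≤⟨ s≤s (length-≤-injection φ uniq (λ p q → inj (there p) (there q)) into′) ⟩
    suc (length (as ++ bs))        ≡⟨ cong suc (length-++ as) ⟩
    suc (length as + length bs)    ≡⟨ +-suc (length as) (length bs) ⟨
    length as + length (φ x ∷ bs)  ≡⟨ length-++ as ⟨
    length (as ++ φ x ∷ bs)        ∎
  where
  open ≤-Reasoning
  into′ : ∀ {z} → z ∈ xs → φ z ∈ as ++ bs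
  into′ z∈xs = ∈-delete as (into (there z∈xs))
                 (λ φz≡φx → All.lookup x∉xs z∈xs (sym (inj (there z∈xs) (here refl) φz≡φx)))

countᶠ : ∀ {n} → (Fin n → Bool) → ℕ
countᶠ {zero}  p = 0
countᶠ {suc n} p = 𝟙 (p zero) + countᶠ (p ∘ suc)

countᵇ-tabulate : ∀ {n} (p : A → Bool) (f : Fin n → A) → countᵇ p (tabulate f) ≡ countᶠ (p ∘ f)
countᵇ-tabulate {n = zero}  p f = refl
countᵇ-tabulate {n = suc n} p f =
  trans (countᵇ-∷ p (f zero) _) (cong (𝟙 (p (f zero)) +_) (countᵇ-tabulate p (f ∘ suc)))

countᶠ-≤ : ∀ {n} (p : Fin n → Bool) → countᶠ p ≤ n
countᶠ-≤ {zero}  p = z≤n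
countᶠ-≤ {suc n} p with p zero
... | true  = s≤s (countᶠ-≤ (p ∘ suc))
... | false = m≤n⇒m≤1+n (countᶠ-≤ (p ∘ suc))

countᶠ-<ᵇ : ∀ n t → countᶠ {n} (λ c → toℕ c <ᵇ t) ≤ t
countᶠ-<ᵇ zero    t       = z≤n
countᶠ-<ᵇ (suc n) zero    = countᶠ-<ᵇ n zero
countᶠ-<ᵇ (suc n) (suc t) = s≤s (countᶠ-<ᵇ n t)

∏ : ∀ {n} → (Fin n → ℕ) → ℕ
∏ {zero}  g = 1
∏ {suc n} g = g zero * ∏ (g ∘ suc)

∏-mono-≤ : ∀ {n} {g h : Fin n → ℕ} → (∀ i → g i ≤ h i) → ∏ g ≤ ∏ h
∏-mono-≤ {zero}  _   = ≤-refl
∏-mono-≤ {suc n} g≤h = *-mono-≤ (g≤h zero) (∏-mono-≤ (g≤h ∘ suc))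

*-∏-≤ : ∀ {n} {g h : Fin n → ℕ} (c : ℕ) (z : Fin n) →
        (∀ i → g i ≤ h i) → c * g z ≤ h z → c * ∏ g ≤ ∏ h
*-∏-≤ {suc n} {g} {h} c zero    g≤h cgz≤hz = begin
  c * (g zero * ∏ (g ∘ suc))  ≡⟨ *-assoc c (g zero) _ ⟨
  c * g zero * ∏ (g ∘ suc)    ≤⟨ *-mono-≤ cgz≤hz (∏-mono-≤ (g≤h ∘ suc)) ⟩
  h zero * ∏ (h ∘ suc)        ∎
  where open ≤-Reasoning
*-∏-≤ {suc n} {g} {h} c (suc z) g≤h cgz≤hz = begin
  c * (g zero * ∏ (g ∘ suc))  ≡⟨ *-left-comm c (g zero) _ ⟩
  g zero * (c * ∏ (g ∘ suc))  ≤⟨ *-mono-≤ (g≤h zero) (*-∏-≤ c z (g≤h ∘ suc) cgz≤hz) ⟩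
  h zero * ∏ (h ∘ suc)        ∎
  where open ≤-Reasoning

∏-if : ∀ {n} (a b : ℕ) (L : Fin n → Bool) →
       ∏ (λ i → if L i then a else b) ≡ a ^ countᶠ L * b ^ (n ∸ countᶠ L)
∏-if {zero}  a b L = refl
∏-if {suc n} a b L with L zero | ∏-if a b (L ∘ suc) | countᶠ-≤ (L ∘ suc)
... | true  | ih | _   = trans (cong (a *_) ih) (sym (*-assoc a _ _))
... | false | ih | c≤n = begin
  b * ∏ (λ i → if L (suc i) then a else b)  ≡⟨ cong (b *_) ih ⟩
  b * (a ^ c * b ^ (n ∸ c))                 ≡⟨ *-left-comm b (a ^ c) _ ⟩
  a ^ c * b ^ suc (n ∸ c)                   ≡⟨ cong (λ e → a ^ c * b ^ e) (+-∸-assoc 1 c≤n) ⟨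
  a ^ c * b ^ (suc n ∸ c)                   ∎
  where
  open ≡-Reasoning
  c = countᶠ (L ∘ suc)

∏-≤-mixed-powers : ∀ {n} (q : ℕ) .{{_ : NonZero q}} (L : Fin n → Bool) (g : Fin n → ℕ) (z : Fin n) →
                   (∀ i → g i ≤ (if L i then suc q else q)) → g z ≤ 1 →
                   ∏ g ≤ suc q ^ countᶠ L * q ^ (n ∸ countᶠ L ∸ 1)
∏-≤-mixed-powers {n} q L g z g≤h gz≤1 = drop-factor (n ∸ countᶠ L) {∏ g} {suc q ^ countᶠ L}
  (≤-trans (∏-mono-≤ g≤h) (≤-reflexive (∏-if (suc q) q L)))
  (≤-trans (*-∏-≤ q z g≤h (≤-trans (*-monoʳ-≤ q gz≤1) (q≤ (L z)))) (≤-reflexive (∏-if (suc q) q L)))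
  where
  q≤ : ∀ b → q * 1 ≤ (if b then suc q else q)
  q≤ true  = ≤-trans (≤-reflexive (*-identityʳ q)) (n≤1+n q)
  q≤ false = ≤-reflexive (*-identityʳ q)
  drop-factor : ∀ e {x y} → x ≤ y * q ^ e → q * x ≤ y * q ^ e → x ≤ y * q ^ (e ∸ 1)
  drop-factor zero    x≤ _   = x≤
  drop-factor (suc e) {y = y} _ qx≤ = *-cancelˡ-≤ q (≤-trans qx≤ (≤-reflexive (*-left-comm y q (q ^ e))))

allColourings-suc : ∀ k n → allColourings k (suc n) ≡ cartesianProductWith _∷_ (allFin k) (allColourings k n)
allColourings-suc k n = go (allFin k)
  where
  go : ∀ cs → concatMap (λ c → map (c ∷_) (allColourings k n)) cs ≡ cartesianProductWith _∷_ cs (allColourings k n)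
  go []       = refl
  go (c ∷ cs) = cong (map (c ∷_) (allColourings k n) ++_) (go cs)

∈-allColourings : ∀ {k n} (f : Vec (Fin k) n) → f ∈ allColourings k n
∈-allColourings []                  = here refl
∈-allColourings {k} {suc n} (c ∷ f) = subst ((c ∷ f) ∈_) (sym (allColourings-suc k n))
  (∈-cartesianProductWith⁺ _∷_ (∈-allFin c) (∈-allColourings f))

allColourings-unique : ∀ k n → Unique (allColourings k n)
allColourings-unique k zero    = [] ∷ []
allColourings-unique k (suc n) = subst Unique (sym (allColourings-suc k n))
  (Unique.cartesianProductWith⁺ _∷_ Vecₚ.∷-injective (Unique.allFin⁺ k) (allColourings-unique k n))

lookup-ext : ∀ {n} {f g : Vec A n} → (∀ i → lookup f i ≡ lookup g i) → f ≡ g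
lookup-ext {f = f} {g} f≗g =
  trans (sym (Vecₚ.tabulate∘lookup f)) (trans (Vecₚ.tabulate-cong f≗g) (Vecₚ.tabulate∘lookup g))

inBox : ∀ {k n} → (Fin n → ℕ) → Vec (Fin k) n → Bool
inBox w []      = true
inBox w (c ∷ f) = (toℕ c <ᵇ w zero) ∧ inBox (w ∘ suc) f

inBox-intro : ∀ {k n} (w : Fin n → ℕ) (f : Vec (Fin k) n) → (∀ i → toℕ (lookup f i) < w i) → T (inBox w f)
inBox-intro w []      _   = _
inBox-intro w (c ∷ f) f<w = Equivalence.from T-∧ (<⇒<ᵇ (f<w zero) , inBox-intro (w ∘ suc) f (f<w ∘ suc))

countᵇ-inBox : ∀ k n (w : Fin n → ℕ) → countᵇ (inBox w) (allColourings k n) ≤ ∏ w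
countᵇ-inBox k zero    w = ≤-refl
countᵇ-inBox k (suc n) w = begin
  countᵇ (inBox w) (allColourings k (suc n))
    ≡⟨ cong (countᵇ (inBox w)) (allColourings-suc k n) ⟩
  countᵇ (inBox w) (cartesianProductWith _∷_ (allFin k) (allColourings k n))
    ≡⟨ countᵇ-cartesianProductWith _∷_ (inBox w) below (inBox (w ∘ suc)) (λ _ _ → refl) (allFin k) _ ⟩
  countᵇ below (allFin k) * countᵇ (inBox (w ∘ suc)) (allColourings k n)
    ≤⟨ *-mono-≤ (≤-reflexive (countᵇ-tabulate below (λ c → c))) (countᵇ-inBox k n (w ∘ suc)) ⟩
  countᶠ below * ∏ (w ∘ suc)
    ≤⟨ *-monoˡ-≤ (∏ (w ∘ suc)) (countᶠ-<ᵇ k (w zero)) ⟩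
  ∏ w ∎
  where
  open ≤-Reasoning
  below : Fin k → Bool
  below c = toℕ c <ᵇ w zero

-- A breadth-first spanning forest

=ᶠ⇒≡ : ∀ {n} {i j : Fin n} → T (i =ᶠ j) → i ≡ j
=ᶠ⇒≡ {i = i} {j} i=j = toℕ-injective (≡ᵇ⇒≡ (toℕ i) (toℕ j) i=j)

≡⇒=ᶠ : ∀ {n} {i j : Fin n} → i ≡ j → T (i =ᶠ j)
≡⇒=ᶠ {i = i} {j} i≡j = ≡⇒≡ᵇ (toℕ i) (toℕ j) (cong toℕ i≡j)

not≡false⇒T : ∀ {b} → not b ≡ false → T b
not≡false⇒T {true} _ = _

least : ∀ {n} → (Fin (suc n) → Bool) → Fin (suc n)
least {zero}  P = zero
least {suc n} P = if P zero then zero else suc (least (P ∘ suc))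

least-satisfies : ∀ {n} (P : Fin (suc n) → Bool) {j} → T (P j) → T (P (least P))
least-satisfies {zero}  P {zero} Pj = Pj
least-satisfies {suc n} P {j}    Pj with P zero in P0 | j
... | true  | _     = subst T (sym P0) _
... | false | zero  = contradiction (subst T P0 Pj) (λ ())
... | false | suc j = least-satisfies (P ∘ suc) Pj

least-≤ : ∀ {n} (P : Fin (suc n) → Bool) {j} → T (P j) → toℕ (least P) ≤ toℕ j
least-≤ {zero}  P {zero} _  = z≤n
least-≤ {suc n} P {j}    Pj with P zero in P0 | j
... | true  | _     = z≤n
... | false | zero  = contradiction (subst T P0 Pj) (λ ())
... | false | suc j = s≤s (least-≤ (P ∘ suc) Pj)

lex-< : ∀ {x x′ y y′ b} → y < b → x < x′ → x * b + y < x′ * b + y′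
lex-< {x} {x′} {y} {y′} {b} y<b x<x′ = begin-strict
  x * b + y    <⟨ +-monoʳ-< (x * b) y<b ⟩
  x * b + b    ≡⟨ +-comm (x * b) b ⟩
  suc x * b    ≤⟨ *-monoˡ-≤ b x<x′ ⟩
  x′ * b       ≤⟨ m≤m+n (x′ * b) y′ ⟩
  x′ * b + y′  ∎
  where open ≤-Reasoning

module _ {n : ℕ} (a : Adj n) where

  reachWithin-mono : ∀ {s t} i j → s ≤ t → T (reachWithin a s i j) → T (reachWithin a t i j)
  reachWithin-mono {s} {t} i j s≤t reach =
    subst (λ u → T (reachWithin a u i j)) (m∸n+n≡m s≤t) (extend (t ∸ s) reach)
    where
    extend : ∀ d {u} → T (reachWithin a u i j) → T (reachWithin a (d + u) i j)
    extend zero    r = r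
    extend (suc d) r = Equivalence.from T-∨ (inj₁ (extend d r))

  reachWithin-last-step : ∀ {t i j} → T (reachWithin a (suc t) i j) → ¬ T (reachWithin a t i j) →
                          ∃[ l ] T (reachWithin a t i l ∧ a l j)
  reachWithin-last-step reach ¬reach with Equivalence.to T-∨ reach
  ... | inj₁ r = contradiction r ¬reach
  ... | inj₂ r = satisfied (any⁻ _ (allFin n) r)

  connected-refl : ∀ i → T (connected a i i)
  connected-refl i = reachWithin-mono {0} {n} i i z≤n (≡⇒=ᶠ {i = i} refl)

module SpanningForest {m : ℕ} (a : Adj (suc m)) where

  N : ℕ
  N = suc m

  -- The predicate counted by k, so that the number of roots is k H by definition.
  isRoot : Fin N → Bool
  isRoot i = not (any (λ j → (toℕ j <ᵇ toℕ i) ∧ connected a j i) (allFin N))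

  root : Fin N → Fin N
  root v = least (λ j → connected a j v)

  depth : Fin N → ℕ
  depth v = toℕ (least (λ (t : Fin (suc N)) → reachWithin a (toℕ t) (root v) v))

  parent : Fin N → Fin N
  parent v = least (λ l → reachWithin a (pred (depth v)) (root v) l ∧ a l v)

  -- rank orders the vertices lexicographically by (root, depth, vertex), as depth v ≤ N.
  -- The root comes first because connected is not shown to be transitive: the parent of v
  -- is only known to have a root no larger than that of v.
  key : Fin N → ℕ
  key v = toℕ (root v) * suc N + depth v

  rank : Fin N → ℕ
  rank v = key v * N + toℕ v

  root-connected : ∀ v → T (connected a (root v) v)
  root-connected v = least-satisfies (λ j → connected a j v) (connected-refl a v)

  root-< : ∀ v → isRoot v ≡ false → toℕ (root v) < toℕ v
  root-< v nonroot
    with j , j<v∧conn ← satisfied (any⁻ _ (allFin N) (not≡false⇒T nonroot))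
    with j<v , conn ← Equivalence.to T-∧ j<v∧conn
    = ≤-<-trans (least-≤ (λ j → connected a j v) conn) (<ᵇ⇒< (toℕ j) (toℕ v) j<v)

  depth-reach : ∀ v → T (reachWithin a (depth v) (root v) v)
  depth-reach v = least-satisfies (λ t → reachWithin a (toℕ t) (root v) v) {fromℕ N}
    (subst (λ t → T (reachWithin a t (root v) v)) (sym (toℕ-fromℕ N)) (root-connected v))

  depth-≤ : ∀ v → depth v ≤ N
  depth-≤ v = toℕ≤pred[n] (least (λ (t : Fin (suc N)) → reachWithin a (toℕ t) (root v) v))

  depth-minimal : ∀ v {t} → t ≤ N → T (reachWithin a t (root v) v) → depth v ≤ t
  depth-minimal v {t} t≤N reach = subst (depth v ≤_) (toℕ-fromℕ< (s≤s t≤N))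
    (least-≤ (λ t → reachWithin a (toℕ t) (root v) v)
      (subst (λ u → T (reachWithin a u (root v) v)) (sym (toℕ-fromℕ< (s≤s t≤N))) reach))

  depth-suc : ∀ v → isRoot v ≡ false → depth v ≡ suc (pred (depth v))
  depth-suc v nonroot with depth v | depth-reach v
  ... | zero  | root≡v = contradiction (cong toℕ (=ᶠ⇒≡ root≡v)) (<⇒≢ (root-< v nonroot))
  ... | suc _ | _      = refl

  parent-spec : ∀ v → isRoot v ≡ false →
                T (reachWithin a (pred (depth v)) (root v) (parent v) ∧ a (parent v) v)
  parent-spec v nonroot =
    least-satisfies (λ l → reachWithin a d (root v) l ∧ a l v) (proj₂ (reachWithin-last-step a {d} reach ¬reach))
    where
    d = pred (depth v)
    reach : T (reachWithin a (suc d) (root v) v)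
    reach = subst (λ t → T (reachWithin a t (root v) v)) (depth-suc v nonroot) (depth-reach v)
    ¬reach : ¬ T (reachWithin a d (root v) v)
    ¬reach r = 1+n≰n (subst (_≤ d) (depth-suc v nonroot) (depth-minimal v (≤-trans pred[n]≤n (depth-≤ v)) r))

  parent-adjacent : ∀ v → isRoot v ≡ false → T (a (parent v) v)
  parent-adjacent v nonroot = proj₂ (Equivalence.to T-∧ (parent-spec v nonroot))

  parent-rank-< : ∀ v → isRoot v ≡ false → rank (parent v) < rank v
  parent-rank-< v nonroot = lex-< (toℕ<n p) key<
    where
    p = parent v
    d = pred (depth v)
    d≤N : d ≤ N
    d≤N = ≤-trans pred[n]≤n (depth-≤ v)
    reach-p : T (reachWithin a d (root v) p)
    reach-p = proj₁ (Equivalence.to T-∧ (parent-spec v nonroot))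
    root-p≤ : toℕ (root p) ≤ toℕ (root v)
    root-p≤ = least-≤ (λ j → connected a j p) (reachWithin-mono a (root v) p d≤N reach-p)
    key< : key p < key v
    key< with m≤n⇒m<n∨m≡n root-p≤
    ... | inj₁ root-p< = lex-< (s≤s (depth-≤ p)) root-p<
    ... | inj₂ root-p≡ = +-mono-≤-< (≤-reflexive (cong (_* suc N) root-p≡)) (begin-strict
      depth p  ≤⟨ depth-minimal p d≤N (subst (λ r → T (reachWithin a d r p)) (toℕ-injective (sym root-p≡)) reach-p) ⟩
      d        <⟨ n<1+n d ⟩
      suc d    ≡⟨ depth-suc v nonroot ⟨
      depth v  ∎)
      where open ≤-Reasoning

  rank-separates : ∀ {u v} → toℕ u < toℕ v → rank u < rank v ⊎ rank v < rank u
  rank-separates {u} {v} u<v with key u ≤? key v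
  ... | yes ku≤kv = inj₁ (+-mono-≤-< (*-monoˡ-≤ N ku≤kv) u<v)
  ... | no  ku≰kv = inj₂ (lex-< (toℕ<n v) (≰⇒> ku≰kv))

-- Encoding colourings along the forest

relative : ∀ {q} → Fin (suc q) → Fin (suc q) → Fin (suc q)
relative p c with p ≟ c
... | yes _   = zero
... | no  p≢c = inject₁ (punchOut p≢c)

relative-< : ∀ {q} {p c : Fin (suc q)} → p ≢ c → toℕ (relative p c) < q
relative-< {q} {p} {c} p≢c with p ≟ c
... | yes p≡c = contradiction p≡c p≢c
... | no  p≢c = subst (_< q) (sym (toℕ-inject₁ _)) (toℕ<n (punchOut p≢c))

relative-injective : ∀ {q} {p c c′ : Fin (suc q)} → p ≢ c → p ≢ c′ →
                     relative p c ≡ relative p c′ → c ≡ c′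
relative-injective {p = p} {c} {c′} p≢c p≢c′ rel≡ with p ≟ c | p ≟ c′
... | yes p≡c | _        = contradiction p≡c p≢c
... | no  _   | yes p≡c′ = contradiction p≡c′ p≢c′
... | no  p≢c | no  p≢c′ = punchOut-injective p≢c p≢c′ (inject₁-injective rel≡)

ProperExcept : ∀ {n k} → Adj n → Fin n → Fin n → Vec (Fin k) n → Set
ProperExcept a x y f =
  ∀ i j → T (a i j) → ¬ (i ≡ x × j ≡ y) → ¬ (i ≡ y × j ≡ x) → lookup f i ≢ lookup f j

MonochromaticOnlyAt : ∀ {n k} → Adj n → Fin n → Fin n → Vec (Fin k) n → Set
MonochromaticOnlyAt a x y f = lookup f x ≡ lookup f y × ProperExcept a x y f

monochromaticOnlyAt-swap : ∀ {n k} {a : Adj n} {x y} {f : Vec (Fin k) n} →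
                           MonochromaticOnlyAt a x y f → MonochromaticOnlyAt a y x f
monochromaticOnlyAt-swap (fx≡fy , proper) = sym fx≡fy , λ i j aij ≢yx ≢xy → proper i j aij ≢xy ≢yx

module ForestCode {m q : ℕ} (a : Adj (suc m)) (z w : Fin (suc m)) where
  open SpanningForest a

  Colouring : Set
  Colouring = Vec (Fin (suc q)) N

  ForestProper : Colouring → Set
  ForestProper f = lookup f z ≡ lookup f w ×
                   (∀ i → i ≢ z → isRoot i ≡ false → lookup f (parent i) ≢ lookup f i)

  width : Fin N → ℕ
  width i with i ≟ z | isRoot i
  ... | yes _ | _     = 1
  ... | no  _ | true  = suc q
  ... | no  _ | false = q

  codeAt : Colouring → Fin N → Fin (suc q)
  codeAt f i with i ≟ z | isRoot i
  ... | yes _ | _     = zero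
  ... | no  _ | true  = lookup f i
  ... | no  _ | false = relative (lookup f (parent i)) (lookup f i)

  code : Colouring → Colouring
  code f = Vec.tabulate (codeAt f)

  width-≤ : .{{_ : NonZero q}} → ∀ i → width i ≤ (if isRoot i then suc q else q)
  width-≤ i with i ≟ z | isRoot i
  ... | yes _ | true  = s≤s z≤n
  ... | yes _ | false = >-nonZero⁻¹ q
  ... | no  _ | true  = ≤-refl
  ... | no  _ | false = ≤-refl

  width-z : width z ≤ 1
  width-z with z ≟ z
  ... | yes _   = ≤-refl
  ... | no  z≢z = contradiction refl z≢z

  codeAt-< : ∀ {f} → ForestProper f → ∀ i → toℕ (codeAt f i) < width i
  codeAt-< {f} (_ , distinct) i with i ≟ z | isRoot i in root?
  ... | yes _   | _     = s≤s z≤n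
  ... | no  _   | true  = toℕ<n (lookup f i)
  ... | no  i≢z | false = relative-< (distinct i i≢z root?)

  code-inBox : ∀ {f} → ForestProper f → T (inBox width (code f))
  code-inBox {f} proper = inBox-intro width (code f)
    (λ i → subst (λ c → toℕ c < width i) (sym (Vecₚ.lookup∘tabulate (codeAt f) i)) (codeAt-< proper i))

  module _ (w≺z : rank w < rank z) where

    forestProper : ∀ {f} → MonochromaticOnlyAt a z w f → ForestProper f
    forestProper (fz≡fw , proper) = fz≡fw , λ i i≢z nonroot →
      proper (parent i) i (parent-adjacent i nonroot)
        (λ (parent≡z , i≡w) →
           <-asym w≺z (subst₂ (λ p j → rank p < rank j) parent≡z i≡w (parent-rank-< i nonroot)))
        (λ (_ , i≡z) → i≢z i≡z)

    codeAt-determines : ∀ {f g} → ForestProper f → ForestProper g → ∀ i → codeAt f i ≡ codeAt g i →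
                        (∀ {u} → rank u < rank i → lookup f u ≡ lookup g u) → lookup f i ≡ lookup g i
    codeAt-determines {f} {g} (fz≡fw , f-distinct) (gz≡gw , g-distinct) i codes≡ earlier
      with i ≟ z | isRoot i in root?
    ... | yes refl | _     = trans fz≡fw (trans (earlier w≺z) (sym gz≡gw))
    ... | no  _    | true  = codes≡
    ... | no  i≢z  | false = relative-injective
      (λ g-parent≡ → f-distinct i i≢z root? (trans (earlier parent≺i) g-parent≡))
      (g-distinct i i≢z root?)
      (trans (cong (λ c → relative c (lookup f i)) (sym (earlier parent≺i))) codes≡)
      where parent≺i = parent-rank-< i root?

    code-injective : ∀ {f g} → ForestProper f → ForestProper g → code f ≡ code g → f ≡ g
    code-injective {f} {g} pf pg code≡ =
      lookup-ext (WF.All.wfRec (On.wellFounded rank <-wellFounded) _ (λ i → lookup f i ≡ lookup g i)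
        (λ i earlier → codeAt-determines pf pg i (codeAt≡ i) earlier))
      where
      codeAt≡ : ∀ i → codeAt f i ≡ codeAt g i
      codeAt≡ i = trans (sym (Vecₚ.lookup∘tabulate (codeAt f) i))
                    (trans (cong (λ c → lookup c i) code≡) (Vecₚ.lookup∘tabulate (codeAt g) i))

    forestProper-length : .{{_ : NonZero q}} (fs : List Colouring) → Unique fs → All ForestProper fs →
                          length fs ≤ suc q ^ countᵇ isRoot (allFin N) * q ^ (N ∸ countᵇ isRoot (allFin N) ∸ 1)
    forestProper-length fs uniq proper = begin
      length fs
        ≤⟨ length-≤-injection code uniq (λ f∈ g∈ → code-injective (All.lookup proper f∈) (All.lookup proper g∈))
             (λ f∈ → ∈-filter⁺ (T? ∘ inBox width) (∈-allColourings _) (code-inBox (All.lookup proper f∈))) ⟩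
      countᵇ (inBox width) (allColourings (suc q) N)       ≤⟨ countᵇ-inBox (suc q) N width ⟩
      ∏ width                                             ≤⟨ ∏-≤-mixed-powers q isRoot width z width-≤ width-z ⟩
      suc q ^ countᶠ isRoot * q ^ (N ∸ countᶠ isRoot ∸ 1)
        ≡⟨ cong (λ r → suc q ^ r * q ^ (N ∸ r ∸ 1)) (countᵇ-tabulate isRoot (λ i → i)) ⟨
      suc q ^ countᵇ isRoot (allFin N) * q ^ (N ∸ countᵇ isRoot (allFin N) ∸ 1) ∎
      where open ≤-Reasoning

open SpanningForest using (isRoot; rank-separates)

monochromaticOnlyAt-length : ∀ {m q} .{{_ : NonZero q}} (a : Adj (suc m)) {x y : Fin (suc m)} → toℕ x < toℕ y →
  (fs : List (Vec (Fin (suc q)) (suc m))) → Unique fs → All (MonochromaticOnlyAt a x y) fs →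
  length fs ≤ suc q ^ countᵇ (isRoot a) (allFin (suc m)) * q ^ (suc m ∸ countᵇ (isRoot a) (allFin (suc m)) ∸ 1)
monochromaticOnlyAt-length a {x} {y} x<y fs uniq mono with rank-separates a x<y
... | inj₁ x≺y = ForestCode.forestProper-length a y x x≺y fs uniq
  (All.map (λ {f} → ForestCode.forestProper a y x x≺y {f} ∘ monochromaticOnlyAt-swap {f = f}) mono)
... | inj₂ y≺x = ForestCode.forestProper-length a x y y≺x fs uniq
  (All.map (λ {f} → ForestCode.forestProper a x y y≺x {f}) mono)

monochromaticOnlyAt-count : ∀ {m q} .{{_ : NonZero q}} (a : Adj (suc m)) {x y : Fin (suc m)} → toℕ x < toℕ y →
  (V : Vec (Fin (suc q)) (suc m) → Bool) → (∀ f → T (V f) → MonochromaticOnlyAt a x y f) →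
  countᵇ V (allColourings (suc q) (suc m))
    ≤ suc q ^ countᵇ (isRoot a) (allFin (suc m)) * q ^ (suc m ∸ countᵇ (isRoot a) (allFin (suc m)) ∸ 1)
monochromaticOnlyAt-count {m} {q} a x<y V V⇒mono = monochromaticOnlyAt-length a x<y _
  (Unique.filter⁺ (T? ∘ V) (allColourings-unique (suc q) (suc m)))
  (All.map (V⇒mono _) (all-filter (T? ∘ V) (allColourings (suc q) (suc m))))

monochromatic : ∀ {n k} → Vec (Fin k) n → Fin n × Fin n → Bool
monochromatic f (i , j) = lookup f i =ᶠ lookup f j

module _ {n : ℕ} (a : Adj n) where

  ∈-edgeList⁺ : ∀ {i j} → toℕ i < toℕ j → T (a i j) → (i , j) ∈ edgeList a
  ∈-edgeList⁺ {i} {j} i<j aij = ∈-filter⁺ (λ (i , j) → T? ((toℕ i <ᵇ toℕ j) ∧ a i j))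
    (∈-cartesianProduct⁺ (∈-allFin i) (∈-allFin j)) (Equivalence.from T-∧ (<⇒<ᵇ i<j , aij))

  ∈-edgeList⁻ : ∀ {i j} → (i , j) ∈ edgeList a → toℕ i < toℕ j × T (a i j)
  ∈-edgeList⁻ {i} {j} ij∈
    with i<j , aij ← Equivalence.to T-∧ (proj₂ (∈-filter⁻ (λ (i , j) → T? ((toℕ i <ᵇ toℕ j) ∧ a i j))
                                         {xs = cartesianProduct (allFin n) (allFin n)} ij∈))
    = <ᵇ⇒< (toℕ i) (toℕ j) i<j , aij

module _ {n : ℕ} (a : Adj n) where

  nearlyProper-sole : ∀ {k} (f : Vec (Fin k) n) → T (isNearlyProper a f) →
    ∃[ e₀ ] e₀ ∈ edgeList a × T (monochromatic f e₀) ×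
            (∀ {e} → e ∈ edgeList a → T (monochromatic f e) → e ≡ e₀)
  nearlyProper-sole f np
    with filterᵇ (monochromatic f) (edgeList a) in monos | ≡ᵇ⇒≡ (countᵇ (monochromatic f) (edgeList a)) 1 np
  ... | e₀ ∷ [] | _
    with e₀∈ , mono₀ ← ∈-filter⁻ (T? ∘ monochromatic f) (subst (e₀ ∈_) (sym monos) (here refl))
    = e₀ , e₀∈ , mono₀ ,
      λ e∈ mono → singleton⁻ (subst (_ ∈_) monos (∈-filter⁺ (T? ∘ monochromatic f) e∈ mono))

  monochromatic-unique : ∀ {k} (f : Vec (Fin k) n) {e e′} → T (isNearlyProper a f) →
                         e ∈ edgeList a → T (monochromatic f e) →
                         e′ ∈ edgeList a → T (monochromatic f e′) → e ≡ e′
  monochromatic-unique f np e∈ mono e′∈ mono′ with _ , _ , _ , sole ← nearlyProper-sole f np =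
    trans (sole e∈ mono) (sym (sole e′∈ mono′))

  deleteEdge-proper : ∀ {k} (f : Vec (Fin k) n) {e} → T (isNearlyProper a f) →
                      e ∈ edgeList a → T (monochromatic f e) → T (isProper (deleteEdge a e) f)
  deleteEdge-proper f {x , y} np xy∈ mono =
    subst (λ ms → T (length ms ≡ᵇ 0)) (sym (filter-none (T? ∘ monochromatic f) (All.tabulate ¬mono))) _
    where
    removed : ∀ {b c d} → T b → T c → ¬ T (not ((b ∧ c) ∨ d))
    removed {true} {true} _ _ ()
    ¬mono : ∀ {e} → e ∈ edgeList (deleteEdge a (x , y)) → ¬ T (monochromatic f e)
    ¬mono {i , j} ij∈ mono′
      with i<j , a′ij ← ∈-edgeList⁻ (deleteEdge a (x , y)) ij∈
      with aij , kept ← Equivalence.to T-∧ a′ij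
      with refl ← monochromatic-unique f np (∈-edgeList⁺ a i<j aij) mono′ xy∈ mono
      = removed (≡⇒=ᶠ {i = x} refl) (≡⇒=ᶠ {i = y} refl) kept

nearlyProper⇒monochromaticOnlyAt : ∀ {n k} (G : Graph n) (f : Vec (Fin k) n) {x y} → T (isNearlyProper (adj G) f) →
  (x , y) ∈ edgeList (adj G) → T (monochromatic f (x , y)) → MonochromaticOnlyAt (adj G) x y f
nearlyProper⇒monochromaticOnlyAt G f {x} {y} np xy∈ mono = =ᶠ⇒≡ mono , proper
  where
  sole : ∀ {e} → e ∈ edgeList (adj G) → T (monochromatic f e) → e ≡ (x , y)
  sole e∈ mono′ = monochromatic-unique (adj G) f np e∈ mono′ xy∈ mono
  proper : ProperExcept (adj G) x y f
  proper i j aij ≢xy ≢yx fi≡fj with <-cmp (toℕ i) (toℕ j)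
  ... | tri< i<j _ _ = ≢xy (,-injective (sole (∈-edgeList⁺ (adj G) i<j aij) (≡⇒=ᶠ fi≡fj)))
  ... | tri≈ _ i≡j _ = subst T (Graph.irrefl G j) (subst (λ i → T (adj G i j)) (toℕ-injective i≡j) aij)
  ... | tri> _ _ j<i = ≢yx (swap (,-injective
         (sole (∈-edgeList⁺ (adj G) j<i (subst T (Graph.sym G i j) aij)) (≡⇒=ᶠ (sym fi≡fj)))))

chi-≤-3 : ∀ n (a : Adj n) → T (colourable a 3) → chi a ≤ 3
chi-≤-3 n a col with colourable a 0
... | true  = z≤n
... | false with n
... | zero  = z≤n
... | suc n₁ with colourable a 1
... | true  = s≤s z≤n
... | false with n₁
... | zero  = s≤s z≤n
... | suc n₂ with colourable a 2
... | true  = s≤s (s≤s z≤n)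
... | false with n₂
... | zero  = s≤s (s≤s z≤n)
... | suc n₃ with colourable a 3
... | true  = s≤s (s≤s (s≤s z≤n))

nearlyProper-critical : ∀ {n} (a : Adj n) (f : Vec (Fin 3) n) {e} → chi a ≡ 4 → T (isNearlyProper a f) →
                        e ∈ edgeList a → T (monochromatic f e) → T (isCritical a e)
nearlyProper-critical {n} a f {e} χ≡4 np e∈ mono =
  subst (λ c → T (chi (deleteEdge a e) <ᵇ c)) (sym χ≡4) (<⇒<ᵇ (s≤s (chi-≤-3 n (deleteEdge a e) colourable₃)))
  where
  colourable₃ : T (colourable (deleteEdge a e) 3)
  colourable₃ = any⁺ (isProper (deleteEdge a e)) (lose (∈-allColourings f) (deleteEdge-proper a f np e∈ mono))

nearlyProperCount-≤ : ∀ {m} (H : Graph (suc m)) → χ H ≡ 4 →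
                      nearlyProperCount H 3 ≤ crit H * 3 ^ k H * 2 ^ (suc m ∸ k H ∸ 1)
nearlyProperCount-≤ {m} H χ≡4 = begin
  countᵇ (isNearlyProper a) colourings
    ≤⟨ countᵇ-union-bound (isNearlyProper a) nearlyProperAt criticalEdges colourings covered ⟩
  sum (map (λ e → countᵇ (nearlyProperAt e) colourings) criticalEdges)
    ≤⟨ sum-map-≤ (λ e → countᵇ (nearlyProperAt e) colourings) bound criticalEdges perEdge ⟩
  crit H * bound
    ≡⟨ *-assoc (crit H) _ _ ⟨
  crit H * 3 ^ k H * 2 ^ (suc m ∸ k H ∸ 1) ∎
  where
  open ≤-Reasoning
  a = adj H
  colourings = allColourings 3 (suc m)
  criticalEdges = filterᵇ (isCritical a) (edgeList a)
  bound = 3 ^ k H * 2 ^ (suc m ∸ k H ∸ 1)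
  nearlyProperAt : Fin (suc m) × Fin (suc m) → Vec (Fin 3) (suc m) → Bool
  nearlyProperAt e f = isNearlyProper a f ∧ monochromatic f e
  covered : ∀ f → T (isNearlyProper a f) → ∃[ e ] e ∈ criticalEdges × T (nearlyProperAt e f)
  covered f np with e , e∈ , mono , _ ← nearlyProper-sole a f np =
    e , ∈-filter⁺ (T? ∘ isCritical a) e∈ (nearlyProper-critical a f χ≡4 np e∈ mono) ,
    Equivalence.from T-∧ (np , mono)
  perEdge : ∀ {e} → e ∈ criticalEdges → countᵇ (nearlyProperAt e) colourings ≤ bound
  perEdge {x , y} e∈ with xy∈ , _ ← ∈-filter⁻ (T? ∘ isCritical a) {xs = edgeList a} e∈ =
    monochromaticOnlyAt-count a (proj₁ (∈-edgeList⁻ a xy∈)) (nearlyProperAt (x , y))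
      (λ f at → let np , mono = Equivalence.to T-∧ at in nearlyProper⇒monochromaticOnlyAt H f np xy∈ mono)

lemma5p3 : ∀ {n} (H : Graph n) → χ H ≡ 4 →
    nearlyProperCount H (χ H ∸ 1) ≤ crit H * 3 ^ k H * 2 ^ (v H ∸ k H ∸ 1)
lemma5p3 {zero}  H ()
lemma5p3 {suc m} H χ≡4 = subst (λ c → nearlyProperCount H (c ∸ 1) ≤ crit H * 3 ^ k H * 2 ^ (v H ∸ k H ∸ 1))
                               (sym χ≡4) (nearlyProperCount-≤ H χ≡4)
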